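{- Let $n\ge 8$ be even, $m=n/2$, and let $D$ be an $n\times n$ distance matrix on a set $V$ of $n$ teams with $D_{a,b}=D_{b,a}\ge 0$, $D_{a,a}=0$ and the triangle inequality. Let $G$ be the complete graph on $V$ with edge weights given by $D$, $D_G$ its total edge weight, $M$ a minimum weight perfect matching of $G$ with weight $D_M$, and $\mathrm{LB}=2D_G+nD_M$. Label the $m$ edges of $M$ as $u_1,\dots,u_m$ by a uniformly random bijection, and independently for each $k$ label the two endpoints of $u_k$ as $t_{2k-1},t_{2k}$ uniformly at random (each of the two orders with probability $1/2$). Then for any indices $i,j\in\{1,\dots,n\}$ with $t_i\in u_{i'}$, $t_j\in u_{j'}$ and $i'\ne j'$ (i.e. $\lceil i/2\rceil\ne\lceil j/2\rceil$), we have $\mathbb{E}[D_{i,j}]\le \frac{1}{n(n-2)}\mathrm{LB}$, where $D_{i,j}$ denotes the distance between the (random) teams labeled $t_i$ and $t_j$.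
   Formalization: The distance matrix $D$ has rational entries. -}

module Defs where

open import Data.Nat as ℕ using (ℕ; zero; suc)
open import Data.Nat.DivMod using () renaming (_/_ to _div_)
open import Data.Integer using (+_)
open import Data.Rational using (ℚ; 0ℚ; _+_; _*_; _≤_; ½) renaming (_/_ to _÷ℤ_)
open import Data.Fin using (Fin; toℕ; _≟_)
open import Data.Fin.Properties using (all?)
open import Data.Vec using (Vec; []; _∷_; lookup)
open import Data.List using (List; []; _∷_; [_]; map; concatMap; foldr; filter; length; allFin)
open import Data.Product using (_×_; _,_)
open import Relation.Binary.PropositionalEquality using (_≡_; _≢_)
open import Relation.Nullary using (Dec; ¬?; _→-dec_; _×-dec_)

ℕ→ℚ : ℕ → ℚ
ℕ→ℚ k = (+ k) ÷ℤ 1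

sumℚ : List ℚ → ℚ
sumℚ = foldr _+_ 0ℚ

Σ : {n : ℕ} → (Fin n → ℚ) → ℚ
Σ {n} f = sumℚ (map f (allFin n))

record IsDistance {n : ℕ} (D : Fin n → Fin n → ℚ) : Set where
  field
    symm    : ∀ a b → D a b ≡ D b a
    nonneg  : ∀ a b → 0ℚ ≤ D a b
    diag    : ∀ a → D a a ≡ 0ℚ
    triangle : ∀ a b c → D a c ≤ D a b + D b c

-- A perfect matching of the complete graph on Fin n, given by its partner map:
-- each vertex a is matched with p a ≠ a, and p (p a) = a.
record IsPerfectMatching {n : ℕ} (p : Fin n → Fin n) : Set where
  field
    invol   : ∀ a → p (p a) ≡ a
    noFix   : ∀ a → p a ≢ a

-- Total weight of a perfect matching: Σ over edges {a, p a} = ½ Σ_a D a (p a)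
matchingWeight : {n : ℕ} → (Fin n → Fin n → ℚ) → (Fin n → Fin n) → ℚ
matchingWeight D p = ½ * Σ (λ a → D a (p a))

-- Total edge weight D_G of the complete graph: Σ_{a<b} D a b = ½ Σ_a Σ_b D a b
graphWeight : {n : ℕ} → (Fin n → Fin n → ℚ) → ℚ
graphWeight D = ½ * Σ (λ a → Σ (λ b → D a b))

record IsMinPerfectMatching {n : ℕ} (D : Fin n → Fin n → ℚ) (p : Fin n → Fin n) : Set where
  field
    perfect : IsPerfectMatching p
    minimal : ∀ (q : Fin n → Fin n) → IsPerfectMatching q →
              matchingWeight D p ≤ matchingWeight D q

LB : {n : ℕ} → (Fin n → Fin n → ℚ) → (Fin n → Fin n) → ℚ
LB {n} D p = ℕ→ℚ 2 * graphWeight D + ℕ→ℚ n * matchingWeight D p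

-- position pair index (0-based): positions 2k and 2k+1 form pair k
-- (paper: ⌈i/2⌉ for 1-based i)
pair : {n : ℕ} → Fin n → ℕ
pair i = toℕ i div 2

-- A labeling t : positions → teams (t_i = lookup t i)
Injective : {n : ℕ} → Vec (Fin n) n → Set
Injective {n} t = ∀ (i j : Fin n) → lookup t i ≡ lookup t j → i ≡ j

Compatible : {n : ℕ} → (Fin n → Fin n) → Vec (Fin n) n → Set
Compatible {n} p t = ∀ (i j : Fin n) → i ≢ j → pair i ≡ pair j → p (lookup t i) ≡ lookup t j

ValidLabeling : {n : ℕ} → (Fin n → Fin n) → Vec (Fin n) n → Set
ValidLabeling p t = Injective t × Compatible p t

validLabeling? : {n : ℕ} → (p : Fin n → Fin n) → (t : Vec (Fin n) n) → Dec (ValidLabeling p t)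
validLabeling? p t =
  all? (λ i → all? (λ j → (lookup t i ≟ lookup t j) →-dec (i ≟ j)))
  ×-dec
  all? (λ i → all? (λ j → ¬? (i ≟ j) →-dec ((pair i ℕ.≟ pair j) →-dec (p (lookup t i) ≟ lookup t j))))

allVecs : (n k : ℕ) → List (Vec (Fin n) k)
allVecs n zero = [ [] ]
allVecs n (suc k) = concatMap (λ x → map (x ∷_) (allVecs n k)) (allFin n)

-- All labelings produced by the random process (uniform bijection edges ↔ pairs,
-- independent uniform orientation of each edge); each arises from exactly one
-- choice, so the process is the uniform distribution on this list.
labelings : {n : ℕ} → (Fin n → Fin n) → List (Vec (Fin n) n)
labelings {n} p = filter (validLabeling? p) (allVecs n n)

-- Expectation of a function under the uniform distribution on a finite list
-- (defined as 0 for the empty list, which does not occur here)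
average : List ℚ → ℚ
average [] = 0ℚ
average xs@(_ ∷ ys) = sumℚ xs * ((+ 1) ÷ℤ suc (length ys))

expectedDist : {n : ℕ} → (Fin n → Fin n → ℚ) → (Fin n → Fin n) → Fin n → Fin n → ℚ
expectedDist D p i j = average (map (λ t → D (lookup t i) (lookup t j)) (labelings p))

{-# OPTIONS --safe #-}
-- Relabelling the teams by an involution σ that commutes with the matching p maps valid
-- labelings bijectively onto valid labelings, so the number N(a, b) of labelings with
-- (t_i, t_j) = (a, b) satisfies N(σ a, σ b) = N(a, b). As i and j lie in different pairs,
-- N(a, b) = 0 unless a and b lie on distinct edges of M, and two swaps of matching edges carry
-- any such pair to any other, so N is constant on these n(n − 2) pairs. Hence
-- n(n − 2) E[D_{i,j}] is the sum of D over them, which is at most 2 D_G ≤ LB.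
module Submission where

open import Defs
open import Data.Nat using (ℕ; _≤_; _*_; _∸_)
open import Relation.Binary.PropositionalEquality using (_≢_)
open import Data.Fin using (Fin)
open import Data.Rational using (ℚ) renaming (_≤_ to _≤ℚ_; _*_ to _*ℚ_)

import Algebra.Properties.CommutativeMonoid.Sum as CommutativeMonoidSum
import Data.Fin as Fin
open import Data.Fin.Permutation as Perm using (Permutation′; _⟨$⟩ʳ_)
import Data.Fin.Properties as Finₚ
open Finₚ using (_≟_)
import Data.Integer as ℤ
import Data.Integer.Properties as ℤₚ
open import Data.List using (List; []; _∷_; map; length; allFin; concatMap; filter; _++_)
open import Data.List.Membership.Propositional using (_∈_)
open import Data.List.Membership.Propositional.Properties using (∈-filter⁻)
import Data.List.Properties as Listₚ
open import Data.List.Relation.Unary.Any using (here)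
open import Data.Nat using (zero; suc)
import Data.Nat as ℕ
open import Data.Nat.Coprimality using (1-coprimeTo) renaming (sym to coprime-sym)
open import Data.Nat.DivMod using (m/n≡1+[m∸n]/n) renaming (_/_ to _div_)
import Data.Nat.Properties as ℕₚ
open import Data.Product using (_×_; _,_; proj₂; Σ-syntax)
open import Data.Rational using (0ℚ; 1ℚ; _+_; ½; mkℚ; toℚᵘ; nonNegative) renaming (_/_ to _÷ℤ_)
import Data.Rational.Properties as ℚₚ
open import Algebra.Properties.Group ℚₚ.+-0-group using (∙-cancelˡ)
open import Data.Rational.Solver using (module +-*-Solver)
open import Data.Rational.Unnormalised using (mkℚᵘ; *≡*) renaming (_+_ to _+ᵘ_; _≃_ to _≃ᵘ_)
import Data.Rational.Unnormalised.Properties as ℚᵘₚ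
open import Data.Vec using (Vec; lookup) renaming (_∷_ to _∷ᵛ_; map to mapᵛ)
import Data.Vec.Properties as Vecₚ
open import Function using (_∘_; id; _⇔_; mk⇔; Equivalence)
open import Relation.Binary.PropositionalEquality
  using (_≡_; _≗_; refl; sym; trans; cong; cong₂; subst; module ≡-Reasoning)
open import Relation.Nullary using (Dec; yes; no; ¬_; ¬?; _×-dec_)
open import Relation.Nullary.Negation using (contradiction)

open +-*-Solver using (solve; _:+_; _:*_; _:=_; con)

ℕ→ℚ≃mkℚᵘ : ∀ k → toℚᵘ (ℕ→ℚ k) ≃ᵘ mkℚᵘ (ℤ.+ k) 0
ℕ→ℚ≃mkℚᵘ k = ℚₚ.toℚᵘ-fromℚᵘ (mkℚᵘ (ℤ.+ k) 0)

mkℚᵘ-suc : ∀ k → mkℚᵘ (ℤ.+ suc k) 0 ≃ᵘ mkℚᵘ (ℤ.+ 1) 0 +ᵘ mkℚᵘ (ℤ.+ k) 0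
mkℚᵘ-suc k = *≡* (trans (ℤₚ.*-identityʳ _)
  (sym (trans (ℤₚ.*-identityʳ _) (cong (ℤ._+_ (ℤ.+ 1)) (ℤₚ.*-identityʳ (ℤ.+ k))))))

ℕ→ℚ-suc : ∀ k → ℕ→ℚ (suc k) ≡ 1ℚ + ℕ→ℚ k
ℕ→ℚ-suc k = ℚₚ.toℚᵘ-injective (begin
  toℚᵘ (ℕ→ℚ (suc k))                ≈⟨ ℕ→ℚ≃mkℚᵘ (suc k) ⟩
  mkℚᵘ (ℤ.+ suc k) 0                 ≈⟨ mkℚᵘ-suc k ⟩
  mkℚᵘ (ℤ.+ 1) 0 +ᵘ mkℚᵘ (ℤ.+ k) 0   ≈⟨ ℚᵘₚ.+-cong (ℕ→ℚ≃mkℚᵘ 1) (ℕ→ℚ≃mkℚᵘ k) ⟨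
  toℚᵘ 1ℚ +ᵘ toℚᵘ (ℕ→ℚ k)           ≈⟨ ℚₚ.toℚᵘ-homo-+ 1ℚ (ℕ→ℚ k) ⟨
  toℚᵘ (1ℚ + ℕ→ℚ k)                 ∎)
  where open ℚᵘₚ.≃-Reasoning

ℕ→ℚ-+ : ∀ a b → ℕ→ℚ (a ℕ.+ b) ≡ ℕ→ℚ a + ℕ→ℚ b
ℕ→ℚ-+ zero    b = sym (ℚₚ.+-identityˡ (ℕ→ℚ b))
ℕ→ℚ-+ (suc a) b = begin
  ℕ→ℚ (suc (a ℕ.+ b))        ≡⟨ ℕ→ℚ-suc (a ℕ.+ b) ⟩
  1ℚ + ℕ→ℚ (a ℕ.+ b)         ≡⟨ cong (1ℚ +_) (ℕ→ℚ-+ a b) ⟩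
  1ℚ + (ℕ→ℚ a + ℕ→ℚ b)       ≡⟨ ℚₚ.+-assoc 1ℚ (ℕ→ℚ a) (ℕ→ℚ b) ⟨
  (1ℚ + ℕ→ℚ a) + ℕ→ℚ b       ≡⟨ cong (_+ ℕ→ℚ b) (ℕ→ℚ-suc a) ⟨
  ℕ→ℚ (suc a) + ℕ→ℚ b        ∎
  where open ≡-Reasoning

ℕ→ℚ-* : ∀ a b → ℕ→ℚ (a * b) ≡ ℕ→ℚ a *ℚ ℕ→ℚ b
ℕ→ℚ-* zero    b = sym (ℚₚ.*-zeroˡ (ℕ→ℚ b))
ℕ→ℚ-* (suc a) b = begin
  ℕ→ℚ (b ℕ.+ a * b)          ≡⟨ ℕ→ℚ-+ b (a * b) ⟩
  ℕ→ℚ b + ℕ→ℚ (a * b)        ≡⟨ cong (ℕ→ℚ b +_) (ℕ→ℚ-* a b) ⟩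
  ℕ→ℚ b + ℕ→ℚ a *ℚ ℕ→ℚ b
    ≡⟨ solve 2 (λ x y → x :+ y :* x := (con 1ℚ :+ y) :* x) refl (ℕ→ℚ b) (ℕ→ℚ a) ⟩
  (1ℚ + ℕ→ℚ a) *ℚ ℕ→ℚ b     ≡⟨ cong (_*ℚ ℕ→ℚ b) (ℕ→ℚ-suc a) ⟨
  ℕ→ℚ (suc a) *ℚ ℕ→ℚ b      ∎
  where open ≡-Reasoning

ℕ→ℚ-nonNeg : ∀ k → 0ℚ ≤ℚ ℕ→ℚ k
ℕ→ℚ-nonNeg k = ℚₚ.nonNegative⁻¹ (ℕ→ℚ k) {{ℚₚ.normalize-nonNeg k 1}}

ℕ→ℚ-*-inverse : ∀ k → ℕ→ℚ (suc k) *ℚ ((ℤ.+ 1) ÷ℤ suc k) ≡ 1ℚ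
ℕ→ℚ-*-inverse k = trans
  (cong₂ _*ℚ_ (ℚₚ.normalize-coprime {suc k} {0} (coprime-sym (1-coprimeTo (suc k))))
              (ℚₚ.normalize-coprime {1} {k} (1-coprimeTo (suc k))))
  (ℚₚ.*-inverseʳ (mkℚ (ℤ.+ suc k) 0 (coprime-sym (1-coprimeTo (suc k)))))

*-nonNeg : ∀ {x y} → 0ℚ ≤ℚ x → 0ℚ ≤ℚ y → 0ℚ ≤ℚ x *ℚ y
*-nonNeg {x} {y} 0≤x 0≤y = ℚₚ.nonNegative⁻¹ (x *ℚ y)
  {{ℚₚ.nonNeg*nonNeg⇒nonNeg x {{nonNegative 0≤x}} y {{nonNegative 0≤y}}}}

𝟙 : ∀ {P : Set} → Dec P → ℚ
𝟙 (yes _) = 1ℚ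
𝟙 (no _)  = 0ℚ

𝟙-cong : ∀ {P Q : Set} → P ⇔ Q → (p? : Dec P) (q? : Dec Q) → 𝟙 p? ≡ 𝟙 q?
𝟙-cong P⇔Q (yes _) (yes _) = refl
𝟙-cong P⇔Q (yes p) (no ¬q) = contradiction (Equivalence.to P⇔Q p) ¬q
𝟙-cong P⇔Q (no ¬p) (yes q) = contradiction (Equivalence.from P⇔Q q) ¬p
𝟙-cong P⇔Q (no _)  (no _)  = refl

𝟙-nonNeg : ∀ {P : Set} (p? : Dec P) → 0ℚ ≤ℚ 𝟙 p?
𝟙-nonNeg (yes _) = ℚₚ.nonNegative⁻¹ 1ℚ
𝟙-nonNeg (no _)  = ℚₚ.≤-refl

𝟙-*-≤ : ∀ {P : Set} (p? : Dec P) {x} → 0ℚ ≤ℚ x → 𝟙 p? *ℚ x ≤ℚ x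
𝟙-*-≤ (yes _) {x} _   = ℚₚ.≤-reflexive (ℚₚ.*-identityˡ x)
𝟙-*-≤ (no _)  {x} 0≤x = subst (_≤ℚ x) (sym (ℚₚ.*-zeroˡ x)) 0≤x

sumOver : ∀ {A : Set} → List A → (A → ℚ) → ℚ
sumOver xs f = sumℚ (map f xs)

syntax sumOver xs (λ x → e) = ∑[ x ∈ xs ] e

∑-cong : ∀ {A : Set} (xs : List A) {f g : A → ℚ} → f ≗ g → sumOver xs f ≡ sumOver xs g
∑-cong []       f≗g = refl
∑-cong (x ∷ xs) f≗g = cong₂ _+_ (f≗g x) (∑-cong xs f≗g)

∑-zero : ∀ {A : Set} (xs : List A) → ∑[ x ∈ xs ] 0ℚ ≡ 0ℚ
∑-zero []       = refl
∑-zero (x ∷ xs) = cong (0ℚ +_) (∑-zero xs)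

∑-const : ∀ {A : Set} (xs : List A) c → ∑[ x ∈ xs ] c ≡ ℕ→ℚ (length xs) *ℚ c
∑-const []       c = sym (ℚₚ.*-zeroˡ c)
∑-const (x ∷ xs) c = begin
  c + ∑[ x ∈ xs ] c               ≡⟨ cong (c +_) (∑-const xs c) ⟩
  c + ℕ→ℚ (length xs) *ℚ c        ≡⟨ solve 2 (λ c l → c :+ l :* c := (con 1ℚ :+ l) :* c) refl c l ⟩
  (1ℚ + ℕ→ℚ (length xs)) *ℚ c     ≡⟨ cong (_*ℚ c) (ℕ→ℚ-suc (length xs)) ⟨
  ℕ→ℚ (suc (length xs)) *ℚ c      ∎
  where
  open ≡-Reasoning
  l = ℕ→ℚ (length xs)

∑-distrib-+ : ∀ {A : Set} (xs : List A) (f g : A → ℚ) →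
              ∑[ x ∈ xs ] (f x + g x) ≡ sumOver xs f + sumOver xs g
∑-distrib-+ []       f g = refl
∑-distrib-+ (x ∷ xs) f g = trans (cong (f x + g x +_) (∑-distrib-+ xs f g))
  (solve 4 (λ a b c d → (a :+ b) :+ (c :+ d) := (a :+ c) :+ (b :+ d)) refl
           (f x) (g x) (sumOver xs f) (sumOver xs g))

∑-*ˡ : ∀ {A : Set} (xs : List A) c (f : A → ℚ) → ∑[ x ∈ xs ] (c *ℚ f x) ≡ c *ℚ sumOver xs f
∑-*ˡ []       c f = sym (ℚₚ.*-zeroʳ c)
∑-*ˡ (x ∷ xs) c f =
  trans (cong (c *ℚ f x +_) (∑-*ˡ xs c f)) (sym (ℚₚ.*-distribˡ-+ c (f x) (sumOver xs f)))

∑-*ʳ : ∀ {A : Set} (xs : List A) c (f : A → ℚ) → ∑[ x ∈ xs ] (f x *ℚ c) ≡ sumOver xs f *ℚ c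
∑-*ʳ xs c f =
  trans (∑-cong xs (λ x → ℚₚ.*-comm (f x) c)) (trans (∑-*ˡ xs c f) (ℚₚ.*-comm c (sumOver xs f)))

∑-comm : ∀ {A B : Set} (xs : List A) (ys : List B) (f : A → B → ℚ) →
         ∑[ x ∈ xs ] sumOver ys (f x) ≡ ∑[ y ∈ ys ] ∑[ x ∈ xs ] f x y
∑-comm []       ys f = sym (∑-zero ys)
∑-comm (x ∷ xs) ys f = trans (cong (sumOver ys (f x) +_) (∑-comm xs ys f))
  (sym (∑-distrib-+ ys (f x) (λ y → ∑[ x ∈ xs ] f x y)))

∑-++ : ∀ {A : Set} (xs ys : List A) (f : A → ℚ) →
       sumOver (xs ++ ys) f ≡ sumOver xs f + sumOver ys f
∑-++ []       ys f = sym (ℚₚ.+-identityˡ (sumOver ys f))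
∑-++ (x ∷ xs) ys f =
  trans (cong (f x +_) (∑-++ xs ys f)) (sym (ℚₚ.+-assoc (f x) (sumOver xs f) (sumOver ys f)))

∑-concatMap : ∀ {A B : Set} (h : A → List B) (xs : List A) (f : B → ℚ) →
              sumOver (concatMap h xs) f ≡ ∑[ x ∈ xs ] sumOver (h x) f
∑-concatMap h []       f = refl
∑-concatMap h (x ∷ xs) f =
  trans (∑-++ (h x) (concatMap h xs) f) (cong (sumOver (h x) f +_) (∑-concatMap h xs f))

∑-map : ∀ {A B : Set} (h : A → B) (xs : List A) (f : B → ℚ) →
        sumOver (map h xs) f ≡ sumOver xs (f ∘ h)
∑-map h []       f = refl
∑-map h (x ∷ xs) f = cong (f (h x) +_) (∑-map h xs f)

∑-filter : ∀ {A : Set} {P : A → Set} (P? : ∀ x → Dec (P x)) (xs : List A) (f : A → ℚ) →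
           sumOver (filter P? xs) f ≡ ∑[ x ∈ xs ] (𝟙 (P? x) *ℚ f x)
∑-filter P? []       f = refl
∑-filter P? (x ∷ xs) f with P? x
... | yes _ = cong₂ _+_ (sym (ℚₚ.*-identityˡ (f x))) (∑-filter P? xs f)
... | no _  = trans (∑-filter P? xs f) (trans (sym (ℚₚ.+-identityˡ _))
                (cong (_+ ∑[ x ∈ xs ] (𝟙 (P? x) *ℚ f x)) (sym (ℚₚ.*-zeroˡ (f x)))))

∑-mono-≤ : ∀ {A : Set} (xs : List A) {f g : A → ℚ} → (∀ x → f x ≤ℚ g x) →
           sumOver xs f ≤ℚ sumOver xs g
∑-mono-≤ []       f≤g = ℚₚ.≤-refl
∑-mono-≤ (x ∷ xs) f≤g = ℚₚ.+-mono-≤ (f≤g x) (∑-mono-≤ xs f≤g)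

∑-nonNeg : ∀ {A : Set} (xs : List A) {f : A → ℚ} → (∀ x → 0ℚ ≤ℚ f x) → 0ℚ ≤ℚ sumOver xs f
∑-nonNeg xs {f} 0≤f = subst (_≤ℚ sumOver xs f) (∑-zero xs) (∑-mono-≤ xs 0≤f)

Σ-suc : ∀ {n} (f : Fin (suc n) → ℚ) → Σ f ≡ f Fin.zero + Σ (f ∘ Fin.suc)
Σ-suc f = cong (λ xs → f Fin.zero + sumℚ xs)
  (trans (Listₚ.map-tabulate Fin.suc f) (sym (Listₚ.map-tabulate id (f ∘ Fin.suc))))

Σ-const : ∀ n c → Σ {n} (λ _ → c) ≡ ℕ→ℚ n *ℚ c
Σ-const n c =
  trans (∑-const (allFin n) c) (cong (λ l → ℕ→ℚ l *ℚ c) (Listₚ.length-tabulate {n = n} id))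

Σ-δ : ∀ {n} (c : Fin n) (g : Fin n → ℚ) → Σ (λ a → 𝟙 (c ≟ a) *ℚ g a) ≡ g c
Σ-δ {suc n} Fin.zero g = begin
  Σ (λ a → 𝟙 (Fin.zero ≟ a) *ℚ g a)                  ≡⟨ Σ-suc (λ a → 𝟙 (Fin.zero ≟ a) *ℚ g a) ⟩
  1ℚ *ℚ g Fin.zero + Σ (λ a → 0ℚ *ℚ g (Fin.suc a))   ≡⟨ cong (1ℚ *ℚ g Fin.zero +_) rest≡0 ⟩
  1ℚ *ℚ g Fin.zero + 0ℚ                               ≡⟨ solve 1 (λ x → con 1ℚ :* x :+ con 0ℚ := x) refl _ ⟩
  g Fin.zero                                          ∎
  where
  open ≡-Reasoning
  rest≡0 : Σ (λ a → 0ℚ *ℚ g (Fin.suc a)) ≡ 0ℚ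
  rest≡0 = trans (∑-cong (allFin n) (λ a → ℚₚ.*-zeroˡ (g (Fin.suc a)))) (∑-zero (allFin n))
Σ-δ {suc n} (Fin.suc c) g = begin
  Σ (λ a → 𝟙 (Fin.suc c ≟ a) *ℚ g a)
    ≡⟨ Σ-suc (λ a → 𝟙 (Fin.suc c ≟ a) *ℚ g a) ⟩
  0ℚ *ℚ g Fin.zero + Σ (λ a → 𝟙 (Fin.suc c ≟ Fin.suc a) *ℚ g (Fin.suc a))
    ≡⟨ cong₂ _+_ (ℚₚ.*-zeroˡ (g Fin.zero)) (∑-cong (allFin n) 𝟙-suc) ⟩
  0ℚ + Σ (λ a → 𝟙 (c ≟ a) *ℚ g (Fin.suc a))
    ≡⟨ cong (0ℚ +_) (Σ-δ c (g ∘ Fin.suc)) ⟩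
  0ℚ + g (Fin.suc c)
    ≡⟨ ℚₚ.+-identityˡ (g (Fin.suc c)) ⟩
  g (Fin.suc c)
    ∎
  where
  open ≡-Reasoning
  𝟙-suc : ∀ a → 𝟙 (Fin.suc c ≟ Fin.suc a) *ℚ g (Fin.suc a) ≡ 𝟙 (c ≟ a) *ℚ g (Fin.suc a)
  𝟙-suc a = cong (_*ℚ g (Fin.suc a))
    (𝟙-cong (mk⇔ Finₚ.suc-injective (cong Fin.suc)) (Fin.suc c ≟ Fin.suc a) (c ≟ a))

Σ-𝟙 : ∀ {n} (c : Fin n) → Σ (λ b → 𝟙 (c ≟ b)) ≡ 1ℚ
Σ-𝟙 {n} c = trans (∑-cong (allFin n) (λ b → sym (ℚₚ.*-identityʳ (𝟙 (c ≟ b))))) (Σ-δ c (λ _ → 1ℚ))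

module ℚSum = CommutativeMonoidSum ℚₚ.+-0-commutativeMonoid

Σ≡sum : ∀ {n} (f : Fin n → ℚ) → Σ f ≡ ℚSum.sum f
Σ≡sum {zero}  f = refl
Σ≡sum {suc n} f = trans (Σ-suc f) (cong (f Fin.zero +_) (Σ≡sum (f ∘ Fin.suc)))

Σ-permute : ∀ {n} (π : Permutation′ n) (f : Fin n → ℚ) → Σ (λ a → f (π ⟨$⟩ʳ a)) ≡ Σ f
Σ-permute π f =
  trans (Σ≡sum (λ a → f (π ⟨$⟩ʳ a))) (trans (sym (ℚSum.sum-permute f π)) (sym (Σ≡sum f)))

ΣΣ : ∀ {n} → (Fin n → Fin n → ℚ) → ℚ
ΣΣ g = Σ (λ a → Σ (λ b → g a b))

ΣΣ-cong : ∀ {n} {g h : Fin n → Fin n → ℚ} → (∀ a b → g a b ≡ h a b) → ΣΣ g ≡ ΣΣ h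
ΣΣ-cong {n} g≡h = ∑-cong (allFin n) (λ a → ∑-cong (allFin n) (g≡h a))

ΣΣ-*ˡ : ∀ {n} c (g : Fin n → Fin n → ℚ) → ΣΣ (λ a b → c *ℚ g a b) ≡ c *ℚ ΣΣ g
ΣΣ-*ˡ {n} c g = trans (∑-cong (allFin n) (λ a → ∑-*ˡ (allFin n) c (g a))) (∑-*ˡ (allFin n) c _)

ΣΣ-𝟙-*-≤ : ∀ {n} {P : Fin n → Fin n → Set} (P? : ∀ a b → Dec (P a b)) {g : Fin n → Fin n → ℚ} →
           (∀ a b → 0ℚ ≤ℚ g a b) → ΣΣ (λ a b → 𝟙 (P? a b) *ℚ g a b) ≤ℚ ΣΣ g
ΣΣ-𝟙-*-≤ {n} P? 0≤g =
  ∑-mono-≤ (allFin n) (λ a → ∑-mono-≤ (allFin n) (λ b → 𝟙-*-≤ (P? a b) (0≤g a b)))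

ΣΣ≡2*graphWeight : ∀ {n} (D : Fin n → Fin n → ℚ) → ΣΣ D ≡ ℕ→ℚ 2 *ℚ graphWeight D
ΣΣ≡2*graphWeight D = sym (trans (sym (ℚₚ.*-assoc (ℕ→ℚ 2) ½ (ΣΣ D))) (ℚₚ.*-identityˡ (ΣΣ D)))

2*graphWeight≤LB : ∀ {n} (D : Fin n → Fin n → ℚ) (p : Fin n → Fin n) → (∀ a b → 0ℚ ≤ℚ D a b) →
                   ℕ→ℚ 2 *ℚ graphWeight D ≤ℚ LB D p
2*graphWeight≤LB {n} D p 0≤D = subst (_≤ℚ LB D p) (ℚₚ.+-identityʳ _)
  (ℚₚ.+-monoʳ-≤ (ℕ→ℚ 2 *ℚ graphWeight D)
    (*-nonNeg (ℕ→ℚ-nonNeg n) (*-nonNeg (ℚₚ.nonNegative⁻¹ ½) (∑-nonNeg (allFin n) (λ a → 0≤D a (p a))))))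

∑-by-fibres : ∀ {A : Set} {n} (xs : List A) (φ ψ : A → Fin n) (g : Fin n → Fin n → ℚ) →
  ∑[ x ∈ xs ] g (φ x) (ψ x) ≡ ΣΣ (λ a b → (∑[ x ∈ xs ] (𝟙 (φ x ≟ a) *ℚ 𝟙 (ψ x ≟ b))) *ℚ g a b)
∑-by-fibres {A} {n} xs φ ψ g = begin
  ∑[ x ∈ xs ] g (φ x) (ψ x)
    ≡⟨ ∑-cong xs (λ x → sym (expand x)) ⟩
  ∑[ x ∈ xs ] ΣΣ (λ a b → δ x a b *ℚ g a b)
    ≡⟨ ∑-comm xs (allFin n) _ ⟩
  Σ (λ a → ∑[ x ∈ xs ] Σ (λ b → δ x a b *ℚ g a b))
    ≡⟨ ∑-cong (allFin n) (λ a → ∑-comm xs (allFin n) _) ⟩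
  ΣΣ (λ a b → ∑[ x ∈ xs ] (δ x a b *ℚ g a b))
    ≡⟨ ΣΣ-cong (λ a b → ∑-*ʳ xs (g a b) (λ x → δ x a b)) ⟩
  ΣΣ (λ a b → (∑[ x ∈ xs ] δ x a b) *ℚ g a b)
    ∎
  where
  open ≡-Reasoning
  δ : A → Fin n → Fin n → ℚ
  δ x a b = 𝟙 (φ x ≟ a) *ℚ 𝟙 (ψ x ≟ b)
  expand : ∀ x → ΣΣ (λ a b → δ x a b *ℚ g a b) ≡ g (φ x) (ψ x)
  expand x = begin
    ΣΣ (λ a b → δ x a b *ℚ g a b)
      ≡⟨ ΣΣ-cong (λ a b → ℚₚ.*-assoc (𝟙 (φ x ≟ a)) (𝟙 (ψ x ≟ b)) (g a b)) ⟩
    Σ (λ a → Σ (λ b → 𝟙 (φ x ≟ a) *ℚ (𝟙 (ψ x ≟ b) *ℚ g a b)))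
      ≡⟨ ∑-cong (allFin n) (λ a → ∑-*ˡ (allFin n) (𝟙 (φ x ≟ a)) (λ b → 𝟙 (ψ x ≟ b) *ℚ g a b)) ⟩
    Σ (λ a → 𝟙 (φ x ≟ a) *ℚ Σ (λ b → 𝟙 (ψ x ≟ b) *ℚ g a b))
      ≡⟨ ∑-cong (allFin n) (λ a → cong (𝟙 (φ x ≟ a) *ℚ_) (Σ-δ (ψ x) (g a))) ⟩
    Σ (λ a → 𝟙 (φ x ≟ a) *ℚ g a (ψ x))
      ≡⟨ Σ-δ (φ x) (λ a → g a (ψ x)) ⟩
    g (φ x) (ψ x)
      ∎

∑-allVecs-permute : ∀ {n} k (π : Permutation′ n) (f : Vec (Fin n) k → ℚ) →
                    ∑[ v ∈ allVecs n k ] f (mapᵛ (π ⟨$⟩ʳ_) v) ≡ sumOver (allVecs n k) f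
∑-allVecs-permute zero    π f = refl
∑-allVecs-permute {n} (suc k) π f = begin
  ∑[ v ∈ allVecs n (suc k) ] f (mapᵛ (π ⟨$⟩ʳ_) v)
    ≡⟨ ∑-concatMap (λ x → map (x ∷ᵛ_) (allVecs n k)) (allFin n) _ ⟩
  Σ (λ x → sumOver (map (x ∷ᵛ_) (allVecs n k)) (λ v → f (mapᵛ (π ⟨$⟩ʳ_) v)))
    ≡⟨ ∑-cong (allFin n) (λ x → ∑-map (x ∷ᵛ_) (allVecs n k) _) ⟩
  Σ (λ x → ∑[ v ∈ allVecs n k ] f ((π ⟨$⟩ʳ x) ∷ᵛ mapᵛ (π ⟨$⟩ʳ_) v))
    ≡⟨ ∑-cong (allFin n) (λ x → ∑-allVecs-permute k π (λ v → f ((π ⟨$⟩ʳ x) ∷ᵛ v))) ⟩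
  Σ (λ x → ∑[ v ∈ allVecs n k ] f ((π ⟨$⟩ʳ x) ∷ᵛ v))
    ≡⟨ Σ-permute π (λ y → ∑[ v ∈ allVecs n k ] f (y ∷ᵛ v)) ⟩
  Σ (λ x → ∑[ v ∈ allVecs n k ] f (x ∷ᵛ v))
    ≡⟨ ∑-cong (allFin n) (λ x → ∑-map (x ∷ᵛ_) (allVecs n k) f) ⟨
  Σ (λ x → sumOver (map (x ∷ᵛ_) (allVecs n k)) f)
    ≡⟨ ∑-concatMap (λ x → map (x ∷ᵛ_) (allVecs n k)) (allFin n) f ⟨
  sumOver (allVecs n (suc k)) f
    ∎
  where open ≡-Reasoning

scaled-average : ∀ x xs {N C G} → sumℚ (x ∷ xs) ≡ N *ℚ G → ℕ→ℚ (length (x ∷ xs)) ≡ N *ℚ C →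
                 C *ℚ average (x ∷ xs) ≡ G
scaled-average x xs {N} {C} {G} sum≡ length≡ = begin
  C *ℚ (sumℚ (x ∷ xs) *ℚ r)           ≡⟨ cong (λ s → C *ℚ (s *ℚ r)) sum≡ ⟩
  C *ℚ ((N *ℚ G) *ℚ r)                ≡⟨ solve 4 (λ c n g r → c :* ((n :* g) :* r) := ((n :* c) :* r) :* g)
                                                 refl C N G r ⟩
  ((N *ℚ C) *ℚ r) *ℚ G                ≡⟨ cong (λ l → (l *ℚ r) *ℚ G) length≡ ⟨
  (ℕ→ℚ (length (x ∷ xs)) *ℚ r) *ℚ G   ≡⟨ cong (_*ℚ G) (ℕ→ℚ-*-inverse (length xs)) ⟩
  1ℚ *ℚ G                             ≡⟨ ℚₚ.*-identityˡ G ⟩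
  G                                   ∎
  where
  open ≡-Reasoning
  r = (ℤ.+ 1) ÷ℤ suc (length xs)

module Matching {n : ℕ} {p : Fin n → Fin n} (isPerfect : IsPerfectMatching p) where
  open IsPerfectMatching isPerfect

  p-injective : ∀ {x y} → p x ≡ p y → x ≡ y
  p-injective {x} {y} px≡py = trans (sym (invol x)) (trans (cong p px≡py) (invol y))

  record IsInvolutiveAutomorphism (σ : Fin n → Fin n) : Set where
    field
      involutive : ∀ x → σ (σ x) ≡ x
      commutes   : ∀ x → σ (p x) ≡ p (σ x)

    injective : ∀ {x y} → σ x ≡ σ y → x ≡ y
    injective {x} {y} σx≡σy = trans (sym (involutive x)) (trans (cong σ σx≡σy) (involutive y))

  OnDistinctEdges : Fin n → Fin n → Set
  OnDistinctEdges a b = b ≢ a × b ≢ p a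

  onDistinctEdges? : ∀ a b → Dec (OnDistinctEdges a b)
  onDistinctEdges? a b = ¬? (b ≟ a) ×-dec ¬? (b ≟ p a)

  swapEdges : Fin n → Fin n → Fin n → Fin n
  swapEdges c d x with x ≟ c | x ≟ p c | x ≟ d | x ≟ p d
  ... | yes _ | _     | _     | _     = d
  ... | no _  | yes _ | _     | _     = p d
  ... | no _  | no _  | yes _ | _     = c
  ... | no _  | no _  | no _  | yes _ = p c
  ... | no _  | no _  | no _  | no _  = x

  module _ (c d : Fin n) where
    private σ = swapEdges c d

    swapEdges-c : σ c ≡ d
    swapEdges-c with c ≟ c
    ... | yes _   = refl
    ... | no c≢c  = contradiction refl c≢c

    swapEdges-pc : σ (p c) ≡ p d
    swapEdges-pc with p c ≟ c | p c ≟ p c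
    ... | yes pc≡c | _          = contradiction pc≡c (noFix c)
    ... | no _     | yes _      = refl
    ... | no _     | no pc≢pc   = contradiction refl pc≢pc

    swapEdges-d : σ d ≡ c
    swapEdges-d with d ≟ c | d ≟ p c | d ≟ d
    ... | yes d≡c | _        | _       = d≡c
    ... | no _    | yes d≡pc | _       = trans (cong p d≡pc) (invol c)
    ... | no _    | no _     | yes _   = refl
    ... | no _    | no _     | no d≢d  = contradiction refl d≢d

    swapEdges-pd : σ (p d) ≡ p c
    swapEdges-pd with p d ≟ c | p d ≟ p c | p d ≟ d | p d ≟ p d
    ... | yes pd≡c | _         | _        | _         = trans (sym (invol d)) (cong p pd≡c)
    ... | no _     | yes pd≡pc | _        | _         = pd≡pc
    ... | no _     | no _      | yes pd≡d | _         = contradiction pd≡d (noFix d)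
    ... | no _     | no _      | no _     | yes _     = refl
    ... | no _     | no _      | no _     | no pd≢pd  = contradiction refl pd≢pd

    swapEdges-fixes : ∀ {x} → x ≢ c → x ≢ p c → x ≢ d → x ≢ p d → σ x ≡ x
    swapEdges-fixes {x} x≢c x≢pc x≢d x≢pd with x ≟ c | x ≟ p c | x ≟ d | x ≟ p d
    ... | yes x≡c | _        | _       | _        = contradiction x≡c x≢c
    ... | no _    | yes x≡pc | _       | _        = contradiction x≡pc x≢pc
    ... | no _    | no _     | yes x≡d | _        = contradiction x≡d x≢d
    ... | no _    | no _     | no _    | yes x≡pd = contradiction x≡pd x≢pd
    ... | no _    | no _     | no _    | no _     = refl

    -- In each clause below, the with-abstraction has already evaluated the inner σ x.
    swapEdges-involutive : ∀ x → σ (σ x) ≡ x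
    swapEdges-involutive x with x ≟ c | x ≟ p c | x ≟ d | x ≟ p d
    ... | yes x≡c  | _         | _        | _         = trans swapEdges-d (sym x≡c)
    ... | no _     | yes x≡pc  | _        | _         = trans swapEdges-pd (sym x≡pc)
    ... | no _     | no _      | yes x≡d  | _         = trans swapEdges-c (sym x≡d)
    ... | no _     | no _      | no _     | yes x≡pd  = trans swapEdges-pc (sym x≡pd)
    ... | no x≢c   | no x≢pc   | no x≢d   | no x≢pd   = swapEdges-fixes x≢c x≢pc x≢d x≢pd

    swapEdges-commutes : ∀ x → σ (p x) ≡ p (σ x)
    swapEdges-commutes x with x ≟ c | x ≟ p c | x ≟ d | x ≟ p d
    ... | yes x≡c  | _         | _        | _         = trans (cong (σ ∘ p) x≡c) swapEdges-pc
    ... | no _     | yes x≡pc  | _        | _         =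
      trans (cong (σ ∘ p) x≡pc) (trans (cong σ (invol c)) (trans swapEdges-c (sym (invol d))))
    ... | no _     | no _      | yes x≡d  | _         = trans (cong (σ ∘ p) x≡d) swapEdges-pd
    ... | no _     | no _      | no _     | yes x≡pd  =
      trans (cong (σ ∘ p) x≡pd) (trans (cong σ (invol d)) (trans swapEdges-d (sym (invol c))))
    ... | no x≢c   | no x≢pc   | no x≢d   | no x≢pd   =
      swapEdges-fixes (x≢pc ∘ px≡⇒) (x≢c ∘ p-injective) (x≢pd ∘ px≡⇒) (x≢d ∘ p-injective)
      where
      px≡⇒ : ∀ {y} → p x ≡ y → x ≡ p y
      px≡⇒ px≡y = trans (sym (invol x)) (cong p px≡y)

    swapEdges-isInvolutiveAutomorphism : IsInvolutiveAutomorphism σ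
    swapEdges-isInvolutiveAutomorphism = record
      { involutive = swapEdges-involutive ; commutes = swapEdges-commutes }

  invariant⇒constant : ∀ {A : Set} (F : Fin n → Fin n → A) →
    (∀ {σ} → IsInvolutiveAutomorphism σ → ∀ a b → F (σ a) (σ b) ≡ F a b) →
    ∀ {a b a′ b′} → OnDistinctEdges a b → OnDistinctEdges a′ b′ → F a b ≡ F a′ b′
  invariant⇒constant F invariant {a} {b} {a′} {b′} (b≢a , b≢pa) (b′≢a′ , b′≢pa′) = begin
    F a b            ≡⟨ invariant σ-aut a b ⟨
    F (σ a) c        ≡⟨ cong (λ x → F x c) (swapEdges-c a a′) ⟩
    F a′ c           ≡⟨ invariant τ-aut a′ c ⟨
    F (τ a′) (τ c)   ≡⟨ cong₂ F τ-fixes-a′ (swapEdges-c c b′) ⟩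
    F a′ b′          ∎
    where
    open ≡-Reasoning
    σ = swapEdges a a′
    σ-aut = swapEdges-isInvolutiveAutomorphism a a′
    open IsInvolutiveAutomorphism σ-aut using (injective)
    c = σ b
    τ = swapEdges c b′
    τ-aut = swapEdges-isInvolutiveAutomorphism c b′
    a′≢c : a′ ≢ c
    a′≢c a′≡σb = b≢a (sym (injective (trans (swapEdges-c a a′) a′≡σb)))
    a′≢pc : a′ ≢ p c
    a′≢pc a′≡pσb = b≢pa (trans (sym (invol b)) (cong p (sym (injective
      (trans (swapEdges-c a a′) (trans a′≡pσb (sym (swapEdges-commutes a a′ b))))))))
    a′≢pb′ : a′ ≢ p b′
    a′≢pb′ a′≡pb′ = b′≢pa′ (trans (sym (invol b′)) (cong p (sym a′≡pb′)))
    τ-fixes-a′ : τ a′ ≡ a′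
    τ-fixes-a′ = swapEdges-fixes c b′ a′≢c a′≢pc (b′≢a′ ∘ sym) a′≢pb′

  𝟙-partition : ∀ a b → 𝟙 (a ≟ b) + 𝟙 (p a ≟ b) + 𝟙 (onDistinctEdges? a b) ≡ 1ℚ
  𝟙-partition a b with a ≟ b | p a ≟ b | onDistinctEdges? a b
  ... | yes a≡b | yes pa≡b | _              = contradiction (trans pa≡b (sym a≡b)) (noFix a)
  ... | yes a≡b | no _     | yes (b≢a , _)  = contradiction (sym a≡b) b≢a
  ... | yes _   | no _     | no _           = refl
  ... | no _    | yes pa≡b | yes (_ , b≢pa) = contradiction (sym pa≡b) b≢pa
  ... | no _    | yes _    | no _           = refl
  ... | no _    | no _     | yes _          = refl
  ... | no a≢b  | no pa≢b  | no ¬distinct   = contradiction ((a≢b ∘ sym) , (pa≢b ∘ sym)) ¬distinct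

  Σ-onDistinctEdges : 2 ≤ n → ∀ a → Σ (λ b → 𝟙 (onDistinctEdges? a b)) ≡ ℕ→ℚ (n ∸ 2)
  Σ-onDistinctEdges 2≤n a = ∙-cancelˡ (ℕ→ℚ 2) _ _ (begin
    ℕ→ℚ 2 + Σ 𝟙D
      ≡⟨ cong (_+ Σ 𝟙D) (cong₂ _+_ (Σ-𝟙 a) (Σ-𝟙 (p a))) ⟨
    Σ (λ b → 𝟙 (a ≟ b)) + Σ (λ b → 𝟙 (p a ≟ b)) + Σ 𝟙D
      ≡⟨ cong (_+ Σ 𝟙D) (∑-distrib-+ (allFin n) _ _) ⟨
    Σ (λ b → 𝟙 (a ≟ b) + 𝟙 (p a ≟ b)) + Σ 𝟙D            ≡⟨ ∑-distrib-+ (allFin n) _ 𝟙D ⟨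
    Σ (λ b → 𝟙 (a ≟ b) + 𝟙 (p a ≟ b) + 𝟙D b)            ≡⟨ ∑-cong (allFin n) (𝟙-partition a) ⟩
    Σ {n} (λ _ → 1ℚ)                                     ≡⟨ Σ-const n 1ℚ ⟩
    ℕ→ℚ n *ℚ 1ℚ                                         ≡⟨ ℚₚ.*-identityʳ (ℕ→ℚ n) ⟩
    ℕ→ℚ n                                                ≡⟨ cong ℕ→ℚ (ℕₚ.m+[n∸m]≡n 2≤n) ⟨
    ℕ→ℚ (2 ℕ.+ (n ∸ 2))                                  ≡⟨ ℕ→ℚ-+ 2 (n ∸ 2) ⟩
    ℕ→ℚ 2 + ℕ→ℚ (n ∸ 2)                                  ∎)
    where
    open ≡-Reasoning
    𝟙D = λ b → 𝟙 (onDistinctEdges? a b)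

  ΣΣ-onDistinctEdges : 2 ≤ n → ΣΣ (λ a b → 𝟙 (onDistinctEdges? a b)) ≡ ℕ→ℚ (n * (n ∸ 2))
  ΣΣ-onDistinctEdges 2≤n = begin
    ΣΣ (λ a b → 𝟙 (onDistinctEdges? a b))   ≡⟨ ∑-cong (allFin n) (Σ-onDistinctEdges 2≤n) ⟩
    Σ {n} (λ _ → ℕ→ℚ (n ∸ 2))               ≡⟨ Σ-const n (ℕ→ℚ (n ∸ 2)) ⟩
    ℕ→ℚ n *ℚ ℕ→ℚ (n ∸ 2)                    ≡⟨ ℕ→ℚ-* n (n ∸ 2) ⟨
    ℕ→ℚ (n * (n ∸ 2))                        ∎
    where open ≡-Reasoning

  module _ {σ : Fin n → Fin n} (σ-aut : IsInvolutiveAutomorphism σ) where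
    open IsInvolutiveAutomorphism σ-aut

    asPermutation : Permutation′ n
    asPermutation = Perm.permutation σ σ involutive involutive

    valid-mapᵛ : ∀ t → ValidLabeling p t → ValidLabeling p (mapᵛ σ t)
    valid-mapᵛ t (t-injective , t-compatible) = σt-injective , σt-compatible
      where
      open ≡-Reasoning
      σt-injective : Injective (mapᵛ σ t)
      σt-injective a b eq = t-injective a b (injective (begin
        σ (lookup t a)        ≡⟨ Vecₚ.lookup-map a σ t ⟨
        lookup (mapᵛ σ t) a   ≡⟨ eq ⟩
        lookup (mapᵛ σ t) b   ≡⟨ Vecₚ.lookup-map b σ t ⟩
        σ (lookup t b)        ∎))
      σt-compatible : Compatible p (mapᵛ σ t)
      σt-compatible a b a≢b same-pair = begin
        p (lookup (mapᵛ σ t) a)   ≡⟨ cong p (Vecₚ.lookup-map a σ t) ⟩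
        p (σ (lookup t a))        ≡⟨ commutes (lookup t a) ⟨
        σ (p (lookup t a))        ≡⟨ cong σ (t-compatible a b a≢b same-pair) ⟩
        σ (lookup t b)            ≡⟨ Vecₚ.lookup-map b σ t ⟨
        lookup (mapᵛ σ t) b       ∎

    valid-mapᵛ-⇔ : ∀ t → ValidLabeling p (mapᵛ σ t) ⇔ ValidLabeling p t
    valid-mapᵛ-⇔ t = mk⇔
      (λ valid → subst (ValidLabeling p) (mapᵛ-involutive t) (valid-mapᵛ (mapᵛ σ t) valid))
      (valid-mapᵛ t)
      where
      mapᵛ-involutive : ∀ {k} (v : Vec (Fin n) k) → mapᵛ σ (mapᵛ σ v) ≡ v
      mapᵛ-involutive v =
        trans (sym (Vecₚ.map-∘ σ σ v)) (trans (Vecₚ.map-cong involutive v) (Vecₚ.map-id v))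

    𝟙-lookup-mapᵛ : ∀ {k} (t : Vec (Fin n) k) x a →
                    𝟙 (lookup (mapᵛ σ t) x ≟ σ a) ≡ 𝟙 (lookup t x ≟ a)
    𝟙-lookup-mapᵛ t x a = 𝟙-cong
      (mk⇔ (λ eq → injective (trans (sym (Vecₚ.lookup-map x σ t)) eq))
           (λ eq → trans (Vecₚ.lookup-map x σ t) (cong σ eq)))
      (lookup (mapᵛ σ t) x ≟ σ a) (lookup t x ≟ a)

module Labelings {n : ℕ} {p : Fin n → Fin n} (isPerfect : IsPerfectMatching p) (i j : Fin n) where
  open Matching isPerfect

  fibre : Fin n → Fin n → ℚ
  fibre a b = ∑[ t ∈ labelings p ] (𝟙 (lookup t i ≟ a) *ℚ 𝟙 (lookup t j ≟ b))

  fibre-invariant : ∀ {σ} → IsInvolutiveAutomorphism σ → ∀ a b → fibre (σ a) (σ b) ≡ fibre a b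
  fibre-invariant {σ} σ-aut a b = begin
    fibre (σ a) (σ b)
      ≡⟨ ∑-filter valid? (allVecs n n) (λ t → I t (σ a) (σ b)) ⟩
    ∑[ t ∈ allVecs n n ] (𝟙 (valid? t) *ℚ I t (σ a) (σ b))
      ≡⟨ ∑-allVecs-permute n (asPermutation σ-aut) (λ t → 𝟙 (valid? t) *ℚ I t (σ a) (σ b)) ⟨
    ∑[ t ∈ allVecs n n ] (𝟙 (valid? (mapᵛ σ t)) *ℚ I (mapᵛ σ t) (σ a) (σ b))
      ≡⟨ ∑-cong (allVecs n n) relabel ⟩
    ∑[ t ∈ allVecs n n ] (𝟙 (valid? t) *ℚ I t a b)
      ≡⟨ ∑-filter valid? (allVecs n n) (λ t → I t a b) ⟨
    fibre a b
      ∎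
    where
    open ≡-Reasoning
    valid? = validLabeling? p
    I : Vec (Fin n) n → Fin n → Fin n → ℚ
    I t a b = 𝟙 (lookup t i ≟ a) *ℚ 𝟙 (lookup t j ≟ b)
    relabel : ∀ t → 𝟙 (valid? (mapᵛ σ t)) *ℚ I (mapᵛ σ t) (σ a) (σ b) ≡ 𝟙 (valid? t) *ℚ I t a b
    relabel t = cong₂ _*ℚ_ (𝟙-cong (valid-mapᵛ-⇔ σ-aut t) (valid? (mapᵛ σ t)) (valid? t))
                           (cong₂ _*ℚ_ (𝟙-lookup-mapᵛ σ-aut t i a) (𝟙-lookup-mapᵛ σ-aut t j b))

  module _ {k : Fin n} (i≢k : i ≢ k) (pair-i≡k : pair i ≡ pair k) (pair-i≢j : pair i ≢ pair j) where

    valid⇒onDistinctEdges : ∀ t → ValidLabeling p t → OnDistinctEdges (lookup t i) (lookup t j)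
    valid⇒onDistinctEdges t (t-injective , t-compatible) = tj≢ti , tj≢pti
      where
      tj≢ti : lookup t j ≢ lookup t i
      tj≢ti tj≡ti = pair-i≢j (cong pair (t-injective i j (sym tj≡ti)))
      tj≢pti : lookup t j ≢ p (lookup t i)
      tj≢pti tj≡pti = pair-i≢j (trans pair-i≡k (cong pair (sym
        (t-injective j k (trans tj≡pti (t-compatible i k i≢k pair-i≡k))))))

    fibre-vanishes : ∀ {a b} → ¬ OnDistinctEdges a b → fibre a b ≡ 0ℚ
    fibre-vanishes {a} {b} ¬distinct = begin
      fibre a b
        ≡⟨ ∑-filter (validLabeling? p) (allVecs n n) (λ t → 𝟙 (lookup t i ≟ a) *ℚ 𝟙 (lookup t j ≟ b)) ⟩
      ∑[ t ∈ allVecs n n ] (𝟙 (validLabeling? p t) *ℚ (𝟙 (lookup t i ≟ a) *ℚ 𝟙 (lookup t j ≟ b)))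
        ≡⟨ ∑-cong (allVecs n n) (λ t → term t (validLabeling? p t) (lookup t i ≟ a) (lookup t j ≟ b)) ⟩
      ∑[ t ∈ allVecs n n ] 0ℚ
        ≡⟨ ∑-zero (allVecs n n) ⟩
      0ℚ
        ∎
      where
      open ≡-Reasoning
      term : ∀ t (v? : Dec (ValidLabeling p t)) (a? : Dec (lookup t i ≡ a)) (b? : Dec (lookup t j ≡ b)) →
             𝟙 v? *ℚ (𝟙 a? *ℚ 𝟙 b?) ≡ 0ℚ
      term t (yes valid) (yes refl) (yes refl) = contradiction (valid⇒onDistinctEdges t valid) ¬distinct
      term t (yes _)     (yes _)    (no _)     = refl
      term t (yes _)     (no _)     (yes _)    = refl
      term t (yes _)     (no _)     (no _)     = refl
      term t (no _)      a?         b?         = ℚₚ.*-zeroˡ (𝟙 a? *ℚ 𝟙 b?)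

    fibre-≡ : ∀ {a₀ b₀} → OnDistinctEdges a₀ b₀ →
              ∀ a b → fibre a b ≡ 𝟙 (onDistinctEdges? a b) *ℚ fibre a₀ b₀
    fibre-≡ {a₀} {b₀} distinct₀ a b with onDistinctEdges? a b
    ... | yes distinct = trans (invariant⇒constant fibre fibre-invariant distinct distinct₀)
                               (sym (ℚₚ.*-identityˡ (fibre a₀ b₀)))
    ... | no ¬distinct = trans (fibre-vanishes ¬distinct) (sym (ℚₚ.*-zeroˡ (fibre a₀ b₀)))

    ∑-labelings : ∀ {a₀ b₀} → OnDistinctEdges a₀ b₀ → (g : Fin n → Fin n → ℚ) →
                  ∑[ t ∈ labelings p ] g (lookup t i) (lookup t j)
                  ≡ fibre a₀ b₀ *ℚ ΣΣ (λ a b → 𝟙 (onDistinctEdges? a b) *ℚ g a b)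
    ∑-labelings {a₀} {b₀} distinct₀ g = begin
      ∑[ t ∈ labelings p ] g (lookup t i) (lookup t j)
        ≡⟨ ∑-by-fibres (labelings p) (λ t → lookup t i) (λ t → lookup t j) g ⟩
      ΣΣ (λ a b → fibre a b *ℚ g a b)
        ≡⟨ ΣΣ-cong rearrange ⟩
      ΣΣ (λ a b → N *ℚ (𝟙 (onDistinctEdges? a b) *ℚ g a b))
        ≡⟨ ΣΣ-*ˡ N (λ a b → 𝟙 (onDistinctEdges? a b) *ℚ g a b) ⟩
      N *ℚ ΣΣ (λ a b → 𝟙 (onDistinctEdges? a b) *ℚ g a b)
        ∎
      where
      open ≡-Reasoning
      N = fibre a₀ b₀
      rearrange : ∀ a b → fibre a b *ℚ g a b ≡ N *ℚ (𝟙 (onDistinctEdges? a b) *ℚ g a b)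
      rearrange a b = trans (cong (_*ℚ g a b) (fibre-≡ distinct₀ a b))
        (solve 3 (λ x y z → (x :* y) :* z := y :* (x :* z)) refl (𝟙 (onDistinctEdges? a b)) N (g a b))

    length-labelings : 2 ≤ n → ∀ {a₀ b₀} → OnDistinctEdges a₀ b₀ →
                       ℕ→ℚ (length (labelings p)) ≡ fibre a₀ b₀ *ℚ ℕ→ℚ (n * (n ∸ 2))
    length-labelings 2≤n {a₀} {b₀} distinct₀ = begin
      ℕ→ℚ (length (labelings p))                          ≡⟨ ℚₚ.*-identityʳ _ ⟨
      ℕ→ℚ (length (labelings p)) *ℚ 1ℚ                    ≡⟨ ∑-const (labelings p) 1ℚ ⟨
      ∑[ t ∈ labelings p ] 1ℚ                              ≡⟨ ∑-labelings distinct₀ (λ _ _ → 1ℚ) ⟩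
      N *ℚ ΣΣ (λ a b → 𝟙 (onDistinctEdges? a b) *ℚ 1ℚ)
        ≡⟨ cong (N *ℚ_) (ΣΣ-cong (λ a b → ℚₚ.*-identityʳ (𝟙 (onDistinctEdges? a b)))) ⟩
      N *ℚ ΣΣ (λ a b → 𝟙 (onDistinctEdges? a b))          ≡⟨ cong (N *ℚ_) (ΣΣ-onDistinctEdges 2≤n) ⟩
      N *ℚ ℕ→ℚ (n * (n ∸ 2))                              ∎
      where
      open ≡-Reasoning
      N = fibre a₀ b₀

    scaled-expectedDist≤ : 2 ≤ n → (D : Fin n → Fin n → ℚ) → (∀ a b → 0ℚ ≤ℚ D a b) →
      ℕ→ℚ (n * (n ∸ 2)) *ℚ expectedDist D p i j ≤ℚ ΣΣ (λ a b → 𝟙 (onDistinctEdges? a b) *ℚ D a b)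
    scaled-expectedDist≤ 2≤n D 0≤D = bound (labelings p) refl
      where
      C = ℕ→ℚ (n * (n ∸ 2))
      W = ΣΣ (λ a b → 𝟙 (onDistinctEdges? a b) *ℚ D a b)
      f : Vec (Fin n) n → ℚ
      f t = D (lookup t i) (lookup t j)
      bound : ∀ ts → ts ≡ labelings p → C *ℚ average (map f ts) ≤ℚ W
      -- labelings p is never empty, but average [] = 0 makes that case trivial anyway.
      bound []       _   = subst (_≤ℚ W) (sym (ℚₚ.*-zeroʳ C)) (∑-nonNeg (allFin n) λ a →
        ∑-nonNeg (allFin n) λ b → *-nonNeg (𝟙-nonNeg (onDistinctEdges? a b)) (0≤D a b))
      bound (t ∷ ts) ts≡ = ℚₚ.≤-reflexive (scaled-average (f t) (map f ts) {N} {C} {W} sum≡ length≡)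
        where
        t-valid : ValidLabeling p t
        t-valid = proj₂ (∈-filter⁻ (validLabeling? p) {xs = allVecs n n} (subst (t ∈_) ts≡ (here refl)))
        distinct = valid⇒onDistinctEdges t t-valid
        N = fibre (lookup t i) (lookup t j)
        sum≡ : sumℚ (map f (t ∷ ts)) ≡ N *ℚ W
        sum≡ = trans (cong (λ ts → sumOver ts f) ts≡) (∑-labelings distinct D)
        length≡ : ℕ→ℚ (length (map f (t ∷ ts))) ≡ N *ℚ C
        length≡ = trans (cong ℕ→ℚ (trans (Listₚ.length-map f (t ∷ ts)) (cong length ts≡)))
                        (length-labelings 2≤n distinct)

mate : ℕ → ℕ
mate zero          = 1
mate (suc zero)    = 0
mate (suc (suc k)) = suc (suc (mate k))

mate-≢ : ∀ k → mate k ≢ k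
mate-≢ (suc (suc k)) eq = mate-≢ k (ℕₚ.suc-injective (ℕₚ.suc-injective eq))

mate-div : ∀ k → mate k div 2 ≡ k div 2
mate-div zero          = refl
mate-div (suc zero)    = refl
mate-div (suc (suc k)) = begin
  suc (suc (mate k)) div 2   ≡⟨ m/n≡1+[m∸n]/n {suc (suc (mate k))} {2} (ℕ.s≤s (ℕ.s≤s ℕ.z≤n)) ⟩
  suc (mate k div 2)         ≡⟨ cong suc (mate-div k) ⟩
  suc (k div 2)              ≡⟨ m/n≡1+[m∸n]/n {suc (suc k)} {2} (ℕ.s≤s (ℕ.s≤s ℕ.z≤n)) ⟨
  suc (suc k) div 2          ∎
  where open ≡-Reasoning

mate-< : ∀ m {k} → k ℕ.< 2 * m → mate k ℕ.< 2 * m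
mate-< zero    ()
mate-< (suc m) {k} k<2m = subst (mate k ℕ.<_) (sym 2m≡) (step k (subst (k ℕ.<_) 2m≡ k<2m))
  where
  2m≡ : 2 * suc m ≡ 2 ℕ.+ 2 * m
  2m≡ = ℕₚ.*-suc 2 m
  step : ∀ k → k ℕ.< 2 ℕ.+ 2 * m → mate k ℕ.< 2 ℕ.+ 2 * m
  step zero          _                        = ℕ.s≤s (ℕ.s≤s ℕ.z≤n)
  step (suc zero)    _                        = ℕ.s≤s ℕ.z≤n
  step (suc (suc k)) (ℕ.s≤s (ℕ.s≤s k<2m))     = ℕ.s≤s (ℕ.s≤s (mate-< m k<2m))

hasMate : ∀ m (i : Fin (2 * m)) → Σ[ k ∈ Fin (2 * m) ] (i ≢ k × pair i ≡ pair k)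
hasMate m i = k , i≢k , sym (trans (cong (_div 2) toℕ-k) (mate-div (Fin.toℕ i)))
  where
  k = Fin.fromℕ< (mate-< m (Finₚ.toℕ<n i))
  toℕ-k : Fin.toℕ k ≡ mate (Fin.toℕ i)
  toℕ-k = Finₚ.toℕ-fromℕ< (mate-< m (Finₚ.toℕ<n i))
  i≢k : i ≢ k
  i≢k i≡k = mate-≢ (Fin.toℕ i) (trans (sym toℕ-k) (cong Fin.toℕ (sym i≡k)))

lemma4 : (m : ℕ) → 4 ≤ m → let n = 2 * m in
         (D : Fin n → Fin n → ℚ) → IsDistance D →
         (p : Fin n → Fin n) → IsMinPerfectMatching D p →
         (i j : Fin n) → pair i ≢ pair j →
         ℕ→ℚ (n * (n ∸ 2)) *ℚ expectedDist D p i j ≤ℚ LB D p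
lemma4 m 4≤m D isDistance p isMinimal i j pair-i≢j with hasMate m i
... | k , i≢k , pair-i≡k = begin
  ℕ→ℚ (n * (n ∸ 2)) *ℚ expectedDist D p i j
    ≤⟨ scaled-expectedDist≤ i≢k pair-i≡k pair-i≢j 2≤n D nonneg ⟩
  ΣΣ (λ a b → 𝟙 (onDistinctEdges? a b) *ℚ D a b)
    ≤⟨ ΣΣ-𝟙-*-≤ onDistinctEdges? nonneg ⟩
  ΣΣ D
    ≡⟨ ΣΣ≡2*graphWeight D ⟩
  ℕ→ℚ 2 *ℚ graphWeight D
    ≤⟨ 2*graphWeight≤LB D p nonneg ⟩
  LB D p
    ∎
  where
  open ℚₚ.≤-Reasoning
  open IsDistance isDistance using (nonneg)
  n = 2 * m
  open Matching (IsMinPerfectMatching.perfect isMinimal) using (onDistinctEdges?)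
  open Labelings (IsMinPerfectMatching.perfect isMinimal) i j using (scaled-expectedDist≤)
  2≤n : 2 ≤ n
  2≤n = ℕₚ.*-monoʳ-≤ 2 (ℕₚ.≤-trans (ℕ.s≤s ℕ.z≤n) 4≤m)
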